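{- For $n \ge 4$ and $r \ge 4$, if $G$ is any complete $r$-partite graph on $n$ vertices, then $\nu(P_3,G) \le \nu(P_3,T_r(n))$.
   Context: All graphs are finite and simple. $P_3$ is the path with 3 edges (4 vertices). $\nu(P_3,G)$ is the number of (not necessarily induced) subgraphs of $G$ isomorphic to $P_3$. A complete $r$-partite graph is one whose vertex set is partitioned into $r$ parts (independent sets) with every pair of vertices in different parts adjacent. The Turán graph $T_r(n)$ is the complete $r$-partite graph on $n$ vertices with parts of sizes $\lfloor n/r\rfloor$ or $\lceil n/r\rceil$. -}

module Defs where

open import Data.Nat using (ℕ; zero; suc; _<ᵇ_)
open import Data.Nat.DivMod using (_mod_)
open import Data.Bool using (Bool; true; false; not; _∧_; if_then_else_)
open import Data.Fin using (Fin; toℕ; _≟_)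
open import Data.List using (List; allFin; map)
open import Data.Nat.ListAction using (sum)
open import Data.Product using (Σ; ∃; _×_; _,_)
open import Relation.Nullary using (yes; no; does)
open import Relation.Binary.PropositionalEquality using (_≡_; refl; sym)

record Graph (n : ℕ) : Set where
  field
    adj   : Fin n → Fin n → Bool
    adj-sym : ∀ u v → adj u v ≡ adj v u
    irrfl : ∀ v → adj v v ≡ false
open Graph public

_≢ᵇ_ : ∀ {k} → Fin k → Fin k → Bool
x ≢ᵇ y = not (does (x ≟ y))

-- ν(P₃, G): number of subgraphs of G isomorphic to the path with 3 edges.
-- Such a subgraph is the path a-b-c-d on four distinct vertices; it is
-- determined by the sequence (a,b,c,d) up to reversal, so we count the
-- sequences with toℕ a < toℕ d (exactly one orientation of each path).
isP3 : ∀ {n} → Graph n → Fin n → Fin n → Fin n → Fin n → Bool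
isP3 G a b c d =
  (a ≢ᵇ b) ∧ (a ≢ᵇ c) ∧ (a ≢ᵇ d) ∧ (b ≢ᵇ c) ∧ (b ≢ᵇ d) ∧ (c ≢ᵇ d) ∧
  adj G a b ∧ adj G b c ∧ adj G c d ∧ (toℕ a <ᵇ toℕ d)

νP3 : ∀ {n} → Graph n → ℕ
νP3 {n} G =
  sum (map (λ a → sum (map (λ b → sum (map (λ c → sum (map (λ d →
    if isP3 G a b c d then 1 else 0) (allFin n))) (allFin n))) (allFin n))) (allFin n))

private
  ≢ᵇ-sym : ∀ {k} (x y : Fin k) → (x ≢ᵇ y) ≡ (y ≢ᵇ x)
  ≢ᵇ-sym x y with x ≟ y | y ≟ x
  ... | yes _ | yes _ = refl
  ... | no _  | no _  = refl
  ... | yes p | no q  with q (sym p)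
  ... | ()
  ≢ᵇ-sym x y | no q | yes p with q (sym p)
  ... | ()

  ≢ᵇ-irr : ∀ {k} (x : Fin k) → (x ≢ᵇ x) ≡ false
  ≢ᵇ-irr x with x ≟ x
  ... | yes _ = refl
  ... | no q with q refl
  ... | ()

completeMultipartite : ∀ {n r} → (Fin n → Fin r) → Graph n
completeMultipartite f = record
  { adj   = λ u v → f u ≢ᵇ f v
  ; adj-sym = λ u v → ≢ᵇ-sym (f u) (f v)
  ; irrfl = λ v → ≢ᵇ-irr (f v) }

IsCompleteMultipartite : ∀ {n} → (r : ℕ) → Graph n → Set
IsCompleteMultipartite {n} r G =
  Σ (Fin n → Fin r) λ f →
    (∀ i → ∃ λ v → f v ≡ i) × (∀ u v → adj G u v ≡ (f u ≢ᵇ f v))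

-- Turán graph T_r(n): vertex v lies in part (toℕ v mod r); the parts then
-- have sizes ⌊n/r⌋ or ⌈n/r⌉.  (r = 0 is degenerate; the edgeless graph.)
turán : (n r : ℕ) → Graph n
turán n zero = record { adj = λ _ _ → false ; adj-sym = λ _ _ → refl ; irrfl = λ _ → refl }
turán n (suc k) = completeMultipartite (λ v → toℕ v mod suc k)

-- Count the paths a b c d of a complete multipartite graph K on n vertices by their middle edge bc:
-- if b and c lie in parts of sizes u and v, the end vertices can be chosen in
-- (n - 1 - u)(n - 1 - v) - (n - u - v) ways.  Summing over bc writes 2ν(P₃, K) as a polynomial in n
-- and the power sums p₂, p₃, p₄ of the part sizes.  Moving one vertex from a part of size q + 1 + d to a
-- part of size q raises this polynomial by 4d((n - 2)R - U₂) + 2d(R(n - 3) + 2q(q + d)), where R and U₂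
-- are the total and the sum of squares of the remaining parts; since U₂ ≤ R², the gain is nonnegative.
-- The Turán part sizes differ by at most one, so from any size vector with total n some part lies
-- above its Turán size and another below it unless the two vectors agree; moving a vertex from the
-- first to the second lowers the ℓ¹-distance to the Turán sizes by two and does not decrease ν(P₃).

module Submission where

open import Defs
open import Data.Bool using (Bool; true; false; not; _∧_; if_then_else_)
open import Data.Empty using (⊥-elim)
open import Data.Fin using (Fin; zero; suc; toℕ; _≟_)
import Data.Fin.Properties as FinP
open import Data.Integer as ℤ using (ℤ; +_; 0ℤ; 1ℤ; _+_; _*_; _-_; -_)
import Data.Integer.Properties as ℤP
open import Data.Integer.Tactic.RingSolver using (solve-∀)
import Data.Nat.Tactic.RingSolver as ℕSolver
open import Data.Vec.Functional using (updateAt)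
open import Data.Vec.Functional.Properties using (updateAt-minimal)
open import Data.List using (allFin; map; tabulate)
open import Data.Nat as ℕ using (ℕ; _≤_; _<_; _<ᵇ_)
open import Data.Nat.ListAction using () renaming (sum to listSum)
import Data.Nat.Properties as ℕP
import Data.Nat.DivMod as DivMod
open import Data.Product using (∃; _,_)
open import Function using (id; _∘_)
open import Relation.Nullary using (¬_; Dec; yes; no; does)
open import Relation.Binary.PropositionalEquality
  using (_≡_; refl; sym; trans; cong; cong₂; subst; module ≡-Reasoning)
open import Relation.Binary.Definitions using (Tri; tri<; tri≈; tri>)
import Algebra.Properties.Semiring.Sum as SemiringSum

open SemiringSum ℤP.+-*-semiring
  using ( sum; sum-syntax; sum-replicate-zero; sum-cong-≗; ∑-comm; ∑-distrib-+
        ; *-distribˡ-sum; *-distribʳ-sum)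
module ℕ∑ = SemiringSum ℕP.+-*-semiring

𝟙ℕ : Bool → ℕ
𝟙ℕ b = if b then 1 else 0

𝟙 : Bool → ℤ
𝟙 b = + 𝟙ℕ b

𝟙-∧ : ∀ a b → 𝟙 (a ∧ b) ≡ 𝟙 a * 𝟙 b
𝟙-∧ true  b = sym (ℤP.*-identityˡ (𝟙 b))
𝟙-∧ false b = refl

𝟙-not : ∀ b → 𝟙 (not b) ≡ 1ℤ - 𝟙 b
𝟙-not true  = refl
𝟙-not false = refl

𝟙ℕ-<ᵇ : ∀ {m k} → m < k → 𝟙ℕ (m <ᵇ k) ≡ 1
𝟙ℕ-<ᵇ {ℕ.zero}  {ℕ.suc k} _             = refl
𝟙ℕ-<ᵇ {ℕ.suc m} {ℕ.suc k} (ℕ.s≤s m<k) = 𝟙ℕ-<ᵇ m<k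

𝟙ℕ-≮ᵇ : ∀ {m k} → k ≤ m → 𝟙ℕ (m <ᵇ k) ≡ 0
𝟙ℕ-≮ᵇ {m}       {ℕ.zero}  _             = refl
𝟙ℕ-≮ᵇ {ℕ.suc m} {ℕ.suc k} (ℕ.s≤s k≤m) = 𝟙ℕ-≮ᵇ k≤m

𝟙ℕ-<ᵇ-suc : ∀ c a → 𝟙ℕ (c <ᵇ a) ℕ.+ 𝟙ℕ (c ℕ.≡ᵇ a) ≡ 𝟙ℕ (c <ᵇ ℕ.suc a)
𝟙ℕ-<ᵇ-suc ℕ.zero    ℕ.zero    = refl
𝟙ℕ-<ᵇ-suc ℕ.zero    (ℕ.suc a) = refl
𝟙ℕ-<ᵇ-suc (ℕ.suc c) ℕ.zero    = refl
𝟙ℕ-<ᵇ-suc (ℕ.suc c) (ℕ.suc a) = 𝟙ℕ-<ᵇ-suc c a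

δ : ∀ {n} → Fin n → Fin n → ℤ
δ x y = 𝟙 (does (x ≟ y))

δ≢ : ∀ {n} → Fin n → Fin n → ℤ
δ≢ x y = 𝟙 (x ≢ᵇ y)

δ-≡ : ∀ {n} {x y : Fin n} → x ≡ y → δ x y ≡ 1ℤ
δ-≡ {x = x} {y} x≡y with x ≟ y
... | yes _   = refl
... | no x≢y = ⊥-elim (x≢y x≡y)

δ-≢ : ∀ {n} {x y : Fin n} → ¬ x ≡ y → δ x y ≡ 0ℤ
δ-≢ {x = x} {y} x≢y with x ≟ y
... | yes x≡y = ⊥-elim (x≢y x≡y)
... | no _    = refl

δ-sym : ∀ {n} (x y : Fin n) → δ x y ≡ δ y x
δ-sym x y with x ≟ y
... | yes x≡y = sym (δ-≡ (sym x≡y))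
... | no x≢y  = sym (δ-≢ (x≢y ∘ sym))

δ≢≡1-δ : ∀ {n} (x y : Fin n) → δ≢ x y ≡ 1ℤ - δ x y
δ≢≡1-δ x y = 𝟙-not (does (x ≟ y))

δ≢-sym : ∀ {n} (x y : Fin n) → δ≢ x y ≡ δ≢ y x
δ≢-sym x y = trans (δ≢≡1-δ x y) (trans (cong (_-_ 1ℤ) (δ-sym x y)) (sym (δ≢≡1-δ y x)))

δ≢-refl : ∀ {n} (x : Fin n) → δ≢ x x ≡ 0ℤ
δ≢-refl x = trans (δ≢≡1-δ x x) (cong (_-_ 1ℤ) (δ-≡ {x = x} refl))

does-≟ : ∀ {n} (x y : Fin n) → does (x ≟ y) ≡ (toℕ x ℕ.≡ᵇ toℕ y)
does-≟ zero    zero    = refl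
does-≟ zero    (suc y) = refl
does-≟ (suc x) zero    = refl
does-≟ (suc x) (suc y) = does-≟ x y

lt : ∀ {n} → Fin n → Fin n → ℤ
lt a d = 𝟙 (toℕ a <ᵇ toℕ d)

δ≢*lt+lt : ∀ {n} (a d : Fin n) → δ≢ a d * (lt a d + lt d a) ≡ δ≢ a d
δ≢*lt+lt a d with a ≟ d
... | yes _   = refl
... | no a≢d = trans (ℤP.*-identityˡ _) (one-orientation (ℕP.<-cmp (toℕ a) (toℕ d)))
  where
  one-orientation : Tri (toℕ a < toℕ d) (toℕ a ≡ toℕ d) (toℕ d < toℕ a) → lt a d + lt d a ≡ 1ℤ
  one-orientation (tri< a<d _ _) = cong₂ (λ x y → + x + + y) (𝟙ℕ-<ᵇ a<d) (𝟙ℕ-≮ᵇ (ℕP.<⇒≤ a<d))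
  one-orientation (tri≈ _ a≡d _) = ⊥-elim (a≢d (FinP.toℕ-injective a≡d))
  one-orientation (tri> _ _ d<a) = cong₂ (λ x y → + x + + y) (𝟙ℕ-≮ᵇ (ℕP.<⇒≤ d<a)) (𝟙ℕ-<ᵇ d<a)

∑-distrib-minus : ∀ {n} (g h : Fin n → ℤ) → ∑[ i < n ] (g i - h i) ≡ sum g - sum h
∑-distrib-minus {ℕ.zero}  g h = refl
∑-distrib-minus {ℕ.suc n} g h =
  trans (cong (_+_ (g zero - h zero)) (∑-distrib-minus (g ∘ suc) (h ∘ suc)))
        (shuffle (g zero) (h zero) (sum (g ∘ suc)) (sum (h ∘ suc)))
  where
  shuffle : ∀ a b c d → a - b + (c - d) ≡ (a + c) - (b + d)
  shuffle = solve-∀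

∑-const : ∀ n c → ∑[ i < n ] c ≡ + n * c
∑-const ℕ.zero    c = sym (ℤP.*-zeroˡ c)
∑-const (ℕ.suc n) c = trans (cong (_+_ c) (∑-const n c)) (lemma (+ n) c)
  where
  lemma : ∀ m c → c + m * c ≡ (1ℤ + m) * c
  lemma = solve-∀

∑-select : ∀ {n} (x : Fin n) (g : Fin n → ℤ) → ∑[ i < n ] (δ x i * g i) ≡ g x
∑-select {ℕ.suc n} zero g = begin
  1ℤ * g zero + ∑[ i < n ] 0ℤ  ≡⟨ cong (_+_ (1ℤ * g zero)) (sum-replicate-zero n) ⟩
  1ℤ * g zero + 0ℤ             ≡⟨ ℤP.+-identityʳ _ ⟩
  1ℤ * g zero                  ≡⟨ ℤP.*-identityˡ _ ⟩
  g zero                       ∎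
  where open ≡-Reasoning
∑-select (suc x) g =
  trans (cong (_+_ (0ℤ * g zero)) (∑-select x (g ∘ suc))) (ℤP.+-identityˡ (g (suc x)))

∑-complement : ∀ {n} (g : Fin n → ℤ) → ∑[ i < n ] (1ℤ - g i) ≡ + n - sum g
∑-complement {n} g =
  trans (∑-distrib-minus (λ _ → 1ℤ) g) (cong (_- sum g) (trans (∑-const n 1ℤ) (ℤP.*-identityʳ (+ n))))

∑-except : ∀ {n} (x : Fin n) (g : Fin n → ℤ) → ∑[ i < n ] (δ≢ x i * g i) ≡ sum g - g x
∑-except {n} x g = begin
  ∑[ i < n ] (δ≢ x i * g i)         ≡⟨ sum-cong-≗ (λ i → trans (cong (_* g i) (δ≢≡1-δ x i)) (expand (δ x i) (g i))) ⟩
  ∑[ i < n ] (g i - δ x i * g i)    ≡⟨ ∑-distrib-minus g (λ i → δ x i * g i) ⟩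
  sum g - ∑[ i < n ] (δ x i * g i)  ≡⟨ cong (_-_ (sum g)) (∑-select x g) ⟩
  sum g - g x                       ∎
  where
  open ≡-Reasoning
  expand : ∀ e y → (1ℤ - e) * y ≡ y - e * y
  expand = solve-∀

∑-linear₄ : ∀ {n} (c₁ c₂ c₃ c₄ : ℤ) (g₁ g₂ g₃ g₄ : Fin n → ℤ) →
  ∑[ i < n ] (c₁ * g₁ i + c₂ * g₂ i + c₃ * g₃ i + c₄ * g₄ i)
    ≡ c₁ * sum g₁ + c₂ * sum g₂ + c₃ * sum g₃ + c₄ * sum g₄
∑-linear₄ c₁ c₂ c₃ c₄ g₁ g₂ g₃ g₄ =
  trans (∑-distrib-+ (λ i → c₁ * g₁ i + c₂ * g₂ i + c₃ * g₃ i) (λ i → c₄ * g₄ i))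
  (cong₂ _+_ (trans (∑-distrib-+ (λ i → c₁ * g₁ i + c₂ * g₂ i) (λ i → c₃ * g₃ i))
    (cong₂ _+_ (trans (∑-distrib-+ (λ i → c₁ * g₁ i) (λ i → c₂ * g₂ i))
      (cong₂ _+_ (sym (*-distribˡ-sum c₁ g₁)) (sym (*-distribˡ-sum c₂ g₂))))
      (sym (*-distribˡ-sum c₃ g₃))))
    (sym (*-distribˡ-sum c₄ g₄)))

∑⁴ : ∀ {n} → (Fin n → Fin n → Fin n → Fin n → ℤ) → ℤ
∑⁴ {n} g = ∑[ a < n ] ∑[ b < n ] ∑[ c < n ] ∑[ d < n ] g a b c d

∑⁴-cong : ∀ {n} {g h : Fin n → Fin n → Fin n → Fin n → ℤ} →
  (∀ a b c d → g a b c d ≡ h a b c d) → ∑⁴ g ≡ ∑⁴ h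
∑⁴-cong g≡h = sum-cong-≗ λ a → sum-cong-≗ λ b → sum-cong-≗ λ c → sum-cong-≗ λ d → g≡h a b c d

∑⁴-distrib-+ : ∀ {n} (g h : Fin n → Fin n → Fin n → Fin n → ℤ) →
  ∑⁴ (λ a b c d → g a b c d + h a b c d) ≡ ∑⁴ g + ∑⁴ h
∑⁴-distrib-+ {n} g h =
  trans (sum-cong-≗ λ a →
    trans (sum-cong-≗ λ b →
      trans (sum-cong-≗ λ c → ∑-distrib-+ (g a b c) (h a b c))
            (∑-distrib-+ (λ c → sum (g a b c)) (λ c → sum (h a b c))))
          (∑-distrib-+ (λ b → ∑[ c < n ] sum (g a b c)) (λ b → ∑[ c < n ] sum (h a b c))))
        (∑-distrib-+ (λ a → ∑[ b < n ] ∑[ c < n ] sum (g a b c)) (λ a → ∑[ b < n ] ∑[ c < n ] sum (h a b c)))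

∑⁴-reverse : ∀ {n} (g : Fin n → Fin n → Fin n → Fin n → ℤ) → ∑⁴ g ≡ ∑⁴ (λ a b c d → g d c b a)
∑⁴-reverse {n} g =
  trans (sum-cong-≗ λ a → ∑³-reverse (g a))
    (trans (∑-comm λ a d → ∑[ c < n ] ∑[ b < n ] g a b c d) (sum-cong-≗ λ d →
      trans (∑-comm λ a c → ∑[ b < n ] g a b c d) (sum-cong-≗ λ c → ∑-comm λ a b → g a b c d)))
  where
  ∑³-reverse : (h : Fin n → Fin n → Fin n → ℤ) →
    ∑[ a < n ] ∑[ b < n ] ∑[ c < n ] h a b c ≡ ∑[ c < n ] ∑[ b < n ] ∑[ a < n ] h a b c
  ∑³-reverse h =
    trans (sum-cong-≗ λ a → ∑-comm (h a))
      (trans (∑-comm λ a c → ∑[ b < n ] h a b c) (sum-cong-≗ λ c → ∑-comm λ a b → h a b c))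

+-ℕ∑ : ∀ {n} (v : Fin n → ℕ) → + ℕ∑.sum v ≡ ∑[ i < n ] (+ v i)
+-ℕ∑ {ℕ.zero}  v = refl
+-ℕ∑ {ℕ.suc n} v = cong (_+_ (+ v zero)) (+-ℕ∑ (v ∘ suc))

+-listSum-tabulate : ∀ {A : Set} {n} (h : Fin n → A) (g : A → ℕ) →
  + listSum (map g (tabulate h)) ≡ ∑[ i < n ] (+ g (h i))
+-listSum-tabulate {n = ℕ.zero}  h g = refl
+-listSum-tabulate {n = ℕ.suc n} h g = cong (_+_ (+ g (h zero))) (+-listSum-tabulate (h ∘ suc) g)

+-square : ∀ a → + (a ℕ.* a) ≡ + a * + a
+-square a = ℤP.pos-* a a

+-cube : ∀ a → + (a ℕ.* a ℕ.* a) ≡ + a * + a * + a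
+-cube a = trans (ℤP.pos-* (a ℕ.* a) a) (cong (_* + a) (+-square a))

+-quartic : ∀ a → + (a ℕ.* a ℕ.* a ℕ.* a) ≡ + a * + a * + a * + a
+-quartic a = trans (ℤP.pos-* (a ℕ.* a ℕ.* a) a) (cong (_* + a) (+-cube a))

cong₄ : ∀ {A B : Set} (g : A → A → A → A → B) {x x′ y y′ z z′ w w′} →
  x ≡ x′ → y ≡ y′ → z ≡ z′ → w ≡ w′ → g x y z w ≡ g x′ y′ z′ w′
cong₄ g refl refl refl refl = refl

νP3≡∑⁴ : ∀ {n} (G : Graph n) → + νP3 G ≡ ∑⁴ λ a b c d → 𝟙 (isP3 G a b c d)
νP3≡∑⁴ {n} G =
  trans (+-listSum-allFin paths₁) (sum-cong-≗ λ a →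
  trans (+-listSum-allFin (paths₂ a)) (sum-cong-≗ λ b →
  trans (+-listSum-allFin (paths₃ a b)) (sum-cong-≗ λ c →
  +-listSum-allFin (λ d → 𝟙ℕ (isP3 G a b c d)))))
  where
  +-listSum-allFin : (g : Fin n → ℕ) → + listSum (map g (allFin n)) ≡ ∑[ i < n ] (+ g i)
  +-listSum-allFin = +-listSum-tabulate id
  paths₃ : Fin n → Fin n → Fin n → ℕ
  paths₃ a b c = listSum (map (λ d → 𝟙ℕ (isP3 G a b c d)) (allFin n))
  paths₂ : Fin n → Fin n → ℕ
  paths₂ a b = listSum (map (paths₃ a b) (allFin n))
  paths₁ : Fin n → ℕ
  paths₁ a = listSum (map (paths₂ a) (allFin n))

νP3-cong : ∀ {n} (G H : Graph n) → (∀ u v → adj G u v ≡ adj H u v) → νP3 G ≡ νP3 H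
νP3-cong G H adj≡ = ℤP.+-injective (begin
  + νP3 G                                ≡⟨ νP3≡∑⁴ G ⟩
  ∑⁴ (λ a b c d → 𝟙 (isP3 G a b c d))   ≡⟨ ∑⁴-cong same-paths ⟩
  ∑⁴ (λ a b c d → 𝟙 (isP3 H a b c d))   ≡⟨ νP3≡∑⁴ H ⟨
  + νP3 H                                ∎)
  where
  open ≡-Reasoning
  same-paths : ∀ a b c d → 𝟙 (isP3 G a b c d) ≡ 𝟙 (isP3 H a b c d)
  same-paths a b c d rewrite adj≡ a b | adj≡ b c | adj≡ c d = refl

pathPoly : ℤ → ℤ → ℤ → ℤ → ℤ
pathPoly m P₂ P₃ P₄ =
  (m * m - + 3 * m + 1ℤ) * (m * m - P₂) - + 2 * m * (m - + 2) * P₂ + P₂ * P₂ + + 2 * (m - + 2) * P₃ - P₄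

p₂ p₃ p₄ : ∀ {r} → (Fin r → ℕ) → ℕ
p₂ v = ℕ∑.sum λ i → v i ℕ.* v i
p₃ v = ℕ∑.sum λ i → v i ℕ.* v i ℕ.* v i
p₄ v = ℕ∑.sum λ i → v i ℕ.* v i ℕ.* v i ℕ.* v i

pathValue : ∀ {r} → (Fin r → ℕ) → ℤ
pathValue v = pathPoly (+ ℕ∑.sum v) (+ p₂ v) (+ p₃ v) (+ p₄ v)

pathValue-cong : ∀ {r} {v w : Fin r → ℕ} → (∀ i → v i ≡ w i) → pathValue v ≡ pathValue w
pathValue-cong v≗w = cong₄ pathPoly
  (cong +_ (ℕ∑.sum-cong-≗ v≗w))
  (cong +_ (ℕ∑.sum-cong-≗ λ i → cong (λ a → a ℕ.* a) (v≗w i)))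
  (cong +_ (ℕ∑.sum-cong-≗ λ i → cong (λ a → a ℕ.* a ℕ.* a) (v≗w i)))
  (cong +_ (ℕ∑.sum-cong-≗ λ i → cong (λ a → a ℕ.* a ℕ.* a ℕ.* a) (v≗w i)))

partSize : ∀ {n r} → (Fin n → Fin r) → Fin r → ℕ
partSize {n} f i = ℕ∑.sum {n} λ d → 𝟙ℕ (does (i ≟ f d))

module CompleteMultipartite {n r} (f : Fin n → Fin r) where

  K : Graph n
  K = completeMultipartite f

  A : Fin n → Fin n → ℤ
  A a b = δ≢ (f a) (f b)

  s : Fin r → ℤ
  s i = ∑[ d < n ] δ i (f d)

  x : Fin n → ℤ
  x b = s (f b)

  A-sym : ∀ a b → A a b ≡ A b a
  A-sym a b = δ≢-sym (f a) (f b)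

  δ≢*A : ∀ a b → δ≢ a b * A a b ≡ A a b
  δ≢*A a b with a ≟ b
  ... | yes refl = sym (δ≢-refl (f a))
  ... | no _     = ℤP.*-identityˡ (A a b)

  path : Fin n → Fin n → Fin n → Fin n → ℤ
  path a b c d = δ≢ c a * δ≢ a d * δ≢ b d * A a b * A b c * A c d

  𝟙-isP3 : ∀ a b c d → 𝟙 (isP3 K a b c d) ≡ path a b c d * lt a d
  𝟙-isP3 a b c d = begin
    𝟙 (isP3 K a b c d)
      ≡⟨ ∧-step (a ≢ᵇ b) (∧-step (a ≢ᵇ c) (∧-step (a ≢ᵇ d) (∧-step (b ≢ᵇ c) (∧-step (b ≢ᵇ d)
           (∧-step (c ≢ᵇ d) (∧-step (f a ≢ᵇ f b) (∧-step (f b ≢ᵇ f c) (𝟙-∧ (f c ≢ᵇ f d) (toℕ a <ᵇ toℕ d))))))))) ⟩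
    δ≢ a b * (δ≢ a c * (δ≢ a d * (δ≢ b c * (δ≢ b d * (δ≢ c d * (A a b * (A b c * (A c d * lt a d))))))))
      ≡⟨ regroup (δ≢ a b) (δ≢ a c) (δ≢ a d) (δ≢ b c) (δ≢ b d) (δ≢ c d) (A a b) (A b c) (A c d) (lt a d) ⟩
    (δ≢ a b * A a b) * (δ≢ b c * A b c) * (δ≢ c d * A c d) * (δ≢ a c * δ≢ a d * δ≢ b d * lt a d)
      ≡⟨ cong₂ (λ u v → u * v * (δ≢ c d * A c d) * (δ≢ a c * δ≢ a d * δ≢ b d * lt a d)) (δ≢*A a b) (δ≢*A b c) ⟩
    A a b * A b c * (δ≢ c d * A c d) * (δ≢ a c * δ≢ a d * δ≢ b d * lt a d)
      ≡⟨ cong₂ (λ u v → A a b * A b c * u * (v * δ≢ a d * δ≢ b d * lt a d)) (δ≢*A c d) (δ≢-sym a c) ⟩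
    A a b * A b c * A c d * (δ≢ c a * δ≢ a d * δ≢ b d * lt a d)
      ≡⟨ regroup′ (A a b) (A b c) (A c d) (δ≢ c a) (δ≢ a d) (δ≢ b d) (lt a d) ⟩
    path a b c d * lt a d ∎
    where
    open ≡-Reasoning
    ∧-step : ∀ p {q z} → 𝟙 q ≡ z → 𝟙 (p ∧ q) ≡ 𝟙 p * z
    ∧-step p {q} e = trans (𝟙-∧ p q) (cong (_*_ (𝟙 p)) e)
    regroup : ∀ ab ac ad bc bd cd Aab Abc Acd l →
      ab * (ac * (ad * (bc * (bd * (cd * (Aab * (Abc * (Acd * l))))))))
        ≡ (ab * Aab) * (bc * Abc) * (cd * Acd) * (ac * ad * bd * l)
    regroup = solve-∀
    regroup′ : ∀ Aab Abc Acd ca ad bd l →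
      Aab * Abc * Acd * (ca * ad * bd * l) ≡ ca * ad * bd * Aab * Abc * Acd * l
    regroup′ = solve-∀

  path-reverse : ∀ a b c d → path d c b a ≡ path a b c d
  path-reverse a b c d = begin
    δ≢ b d * δ≢ d a * δ≢ c a * A d c * A c b * A b a
      ≡⟨ cong₂ (λ u v → u * v * δ≢ c a * A d c * A c b * A b a) (δ≢-sym b d) (δ≢-sym d a) ⟩
    δ≢ d b * δ≢ a d * δ≢ c a * A d c * A c b * A b a
      ≡⟨ cong₂ (λ u v → δ≢ d b * δ≢ a d * δ≢ c a * u * v * A b a) (A-sym d c) (A-sym c b) ⟩
    δ≢ d b * δ≢ a d * δ≢ c a * A c d * A b c * A b a
      ≡⟨ cong₂ (λ u v → u * δ≢ a d * δ≢ c a * A c d * A b c * v) (δ≢-sym d b) (A-sym b a) ⟩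
    δ≢ b d * δ≢ a d * δ≢ c a * A c d * A b c * A a b
      ≡⟨ reorder (δ≢ b d) (δ≢ a d) (δ≢ c a) (A c d) (A b c) (A a b) ⟩
    path a b c d ∎
    where
    open ≡-Reasoning
    reorder : ∀ bd ad ca Acd Abc Aab → bd * ad * ca * Acd * Abc * Aab ≡ ca * ad * bd * Aab * Abc * Acd
    reorder = solve-∀

  path-orientations : ∀ a b c d → path a b c d * lt a d + path a b c d * lt d a ≡ path a b c d
  path-orientations a b c d = begin
    P * lt a d + P * lt d a              ≡⟨ split (δ≢ c a) (δ≢ a d) (δ≢ b d) (A a b) (A b c) (A c d) (lt a d) (lt d a) ⟩
    rest * (δ≢ a d * (lt a d + lt d a))  ≡⟨ cong (_*_ rest) (δ≢*lt+lt a d) ⟩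
    rest * δ≢ a d                        ≡⟨ merge (δ≢ c a) (δ≢ a d) (δ≢ b d) (A a b) (A b c) (A c d) ⟩
    P                                    ∎
    where
    open ≡-Reasoning
    P = path a b c d
    rest = δ≢ c a * (δ≢ b d * A a b * A b c * A c d)
    split : ∀ ca ad bd Aab Abc Acd l l′ →
      ca * ad * bd * Aab * Abc * Acd * l + ca * ad * bd * Aab * Abc * Acd * l′
        ≡ ca * (bd * Aab * Abc * Acd) * (ad * (l + l′))
    split = solve-∀
    merge : ∀ ca ad bd Aab Abc Acd → ca * (bd * Aab * Abc * Acd) * ad ≡ ca * ad * bd * Aab * Abc * Acd
    merge = solve-∀

  twice-νP3≡∑⁴path : + νP3 K + + νP3 K ≡ ∑⁴ path
  twice-νP3≡∑⁴path = begin
    + νP3 K + + νP3 K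
      ≡⟨ cong₂ _+_ forward backward ⟩
    ∑⁴ (λ a b c d → path a b c d * lt a d) + ∑⁴ (λ a b c d → path a b c d * lt d a)
      ≡⟨ ∑⁴-distrib-+ (λ a b c d → path a b c d * lt a d) (λ a b c d → path a b c d * lt d a) ⟨
    ∑⁴ (λ a b c d → path a b c d * lt a d + path a b c d * lt d a)
      ≡⟨ ∑⁴-cong path-orientations ⟩
    ∑⁴ path ∎
    where
    open ≡-Reasoning
    forward : + νP3 K ≡ ∑⁴ (λ a b c d → path a b c d * lt a d)
    forward = trans (νP3≡∑⁴ K) (∑⁴-cong 𝟙-isP3)
    backward : + νP3 K ≡ ∑⁴ (λ a b c d → path a b c d * lt d a)
    backward = trans forward (trans (∑⁴-reverse (λ a b c d → path a b c d * lt a d))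
                                    (∑⁴-cong λ a b c d → cong (_* lt d a) (path-reverse a b c d)))

  A-same : ∀ {b c} → f b ≡ f c → A b c ≡ 0ℤ
  A-same {b} {c} fb≡fc = trans (δ≢≡1-δ (f b) (f c)) (cong (_-_ 1ℤ) (δ-≡ fb≡fc))

  A-diff : ∀ {b c} → ¬ f b ≡ f c → A b c ≡ 1ℤ
  A-diff {b} {c} fb≢fc = trans (δ≢≡1-δ (f b) (f c)) (cong (_-_ 1ℤ) (δ-≢ fb≢fc))

  degree : ∀ c → ∑[ d < n ] A c d ≡ + n - x c
  degree c = trans (sum-cong-≗ λ d → δ≢≡1-δ (f c) (f d)) (∑-complement (λ d → δ (f c) (f d)))

  common-neighbours : ∀ {b c} → ¬ f b ≡ f c → ∑[ a < n ] (A b a * A c a) ≡ + n - x b - x c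
  common-neighbours {b} {c} fb≢fc = begin
    ∑[ a < n ] (A b a * A c a)
      ≡⟨ sum-cong-≗ (λ a → trans (cong₂ _*_ (δ≢≡1-δ (f b) (f a)) (δ≢≡1-δ (f c) (f a)))
                                  (expand (δ (f b) (f a)) (δ (f c) (f a)) (disjoint (f a)))) ⟩
    ∑[ a < n ] ((1ℤ - δ (f b) (f a)) - δ (f c) (f a))
      ≡⟨ ∑-distrib-minus (λ a → 1ℤ - δ (f b) (f a)) (λ a → δ (f c) (f a)) ⟩
    ∑[ a < n ] (1ℤ - δ (f b) (f a)) - x c
      ≡⟨ cong (_- x c) (∑-complement (λ a → δ (f b) (f a))) ⟩
    + n - x b - x c ∎
    where
    open ≡-Reasoning
    disjoint : ∀ i → δ (f b) i * δ (f c) i ≡ 0ℤ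
    disjoint i with f b ≟ i
    ... | yes refl = cong (_*_ 1ℤ) (δ-≢ (fb≢fc ∘ sym))
    ... | no _     = refl
    expand : ∀ u v → u * v ≡ 0ℤ → (1ℤ - u) * (1ℤ - v) ≡ (1ℤ - u) - v
    expand u v uv≡0 = trans (lemma u v) (trans (cong (λ w → (1ℤ - u) - v + w) uv≡0) (ℤP.+-identityʳ _))
      where
      lemma : ∀ u v → (1ℤ - u) * (1ℤ - v) ≡ (1ℤ - u) - v + u * v
      lemma = solve-∀

  avoiding : ∀ a b c → ∑[ d < n ] (δ≢ a d * δ≢ b d * A c d) ≡ + n - x c - A c b - δ≢ b a * A c a
  avoiding a b c = begin
    ∑[ d < n ] (δ≢ a d * δ≢ b d * A c d)    ≡⟨ sum-cong-≗ (λ d → ℤP.*-assoc (δ≢ a d) (δ≢ b d) (A c d)) ⟩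
    ∑[ d < n ] (δ≢ a d * (δ≢ b d * A c d))  ≡⟨ ∑-except a (λ d → δ≢ b d * A c d) ⟩
    ∑[ d < n ] (δ≢ b d * A c d) - δ≢ b a * A c a
      ≡⟨ cong (_- δ≢ b a * A c a) (trans (∑-except b (A c)) (cong (_- A c b) (degree c))) ⟩
    + n - x c - A c b - δ≢ b a * A c a ∎
    where open ≡-Reasoning

  G : ℤ → ℤ → ℤ
  G u v = (+ n - 1ℤ - u) * (+ n - 1ℤ - v) - (+ n - u - v)

  ∑∑path-same : ∀ {b c} → f b ≡ f c → ∑[ a < n ] ∑[ d < n ] path a b c d ≡ A b c * G (x b) (x c)
  ∑∑path-same {b} {c} fb≡fc = begin
    ∑[ a < n ] ∑[ d < n ] path a b c d  ≡⟨ sum-cong-≗ (λ a → sum-cong-≗ λ d → vanishes a d) ⟩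
    ∑[ a < n ] ∑[ d < n ] 0ℤ            ≡⟨ sum-cong-≗ {n} (λ _ → sum-replicate-zero n) ⟩
    ∑[ a < n ] 0ℤ                       ≡⟨ sum-replicate-zero n ⟩
    0ℤ                                  ≡⟨ cong (_* G (x b) (x c)) (A-same fb≡fc) ⟨
    A b c * G (x b) (x c)               ∎
    where
    open ≡-Reasoning
    vanishes : ∀ a d → path a b c d ≡ 0ℤ
    vanishes a d = trans (cong (λ w → δ≢ c a * δ≢ a d * δ≢ b d * A a b * w * A c d) (A-same fb≡fc))
                         (lemma (δ≢ c a * δ≢ a d * δ≢ b d * A a b) (A c d))
      where
      lemma : ∀ u v → u * 0ℤ * v ≡ 0ℤ
      lemma = solve-∀
  module _ {b c} (fb≢fc : ¬ f b ≡ f c) where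

    private
      M : ℤ
      M = + n - x c - 1ℤ

      Y : Fin n → ℤ
      Y a = A a b * M - A b a * A c a

      ∑-path-over-d : ∀ a → ∑[ d < n ] path a b c d ≡ δ≢ c a * Y a
      ∑-path-over-d a = begin
        ∑[ d < n ] path a b c d
          ≡⟨ sum-cong-≗ (λ d → factor (δ≢ c a) (δ≢ a d) (δ≢ b d) (A a b) (A b c) (A c d)) ⟩
        ∑[ d < n ] ((δ≢ c a * A a b * A b c) * (δ≢ a d * δ≢ b d * A c d))
          ≡⟨ *-distribˡ-sum (δ≢ c a * A a b * A b c) (λ d → δ≢ a d * δ≢ b d * A c d) ⟨
        (δ≢ c a * A a b * A b c) * ∑[ d < n ] (δ≢ a d * δ≢ b d * A c d)
          ≡⟨ cong (_*_ (δ≢ c a * A a b * A b c)) (avoiding a b c) ⟩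
        (δ≢ c a * A a b * A b c) * (+ n - x c - A c b - δ≢ b a * A c a)
          ≡⟨ cong₂ (λ u v → (δ≢ c a * A a b * u) * (+ n - x c - v - δ≢ b a * A c a))
                   (A-diff fb≢fc) (A-diff (fb≢fc ∘ sym)) ⟩
        (δ≢ c a * A a b * 1ℤ) * (+ n - x c - 1ℤ - δ≢ b a * A c a)
          ≡⟨ expand (δ≢ c a) (A a b) (δ≢ b a) (A c a) (+ n - x c) ⟩
        δ≢ c a * (A a b * M - (A a b * δ≢ b a) * A c a)
          ≡⟨ cong (λ w → δ≢ c a * (A a b * M - w * A c a)) (trans A*δ≢ (A-sym a b)) ⟩
        δ≢ c a * Y a ∎
        where
        open ≡-Reasoning
        factor : ∀ ca ad bd Aab Abc Acd → ca * ad * bd * Aab * Abc * Acd ≡ (ca * Aab * Abc) * (ad * bd * Acd)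
        factor = solve-∀
        expand : ∀ ca Aab ba Aca N →
          (ca * Aab * 1ℤ) * (N - 1ℤ - ba * Aca) ≡ ca * (Aab * (N - 1ℤ) - (Aab * ba) * Aca)
        expand = solve-∀
        A*δ≢ : A a b * δ≢ b a ≡ A a b
        A*δ≢ = trans (ℤP.*-comm (A a b) (δ≢ b a)) (trans (cong (_* A a b) (δ≢-sym b a)) (δ≢*A a b))

      ∑Y : sum Y ≡ (+ n - x b) * M - (+ n - x b - x c)
      ∑Y = begin
        ∑[ a < n ] (A a b * M - A b a * A c a)
          ≡⟨ ∑-distrib-minus (λ a → A a b * M) (λ a → A b a * A c a) ⟩
        ∑[ a < n ] (A a b * M) - ∑[ a < n ] (A b a * A c a)
          ≡⟨ cong₂ _-_ (sym (*-distribʳ-sum M (λ a → A a b))) (common-neighbours fb≢fc) ⟩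
        ∑[ a < n ] A a b * M - (+ n - x b - x c)
          ≡⟨ cong (λ w → w * M - (+ n - x b - x c)) (trans (sum-cong-≗ λ a → A-sym a b) (degree b)) ⟩
        (+ n - x b) * M - (+ n - x b - x c) ∎
        where open ≡-Reasoning

      Yc : Y c ≡ M
      Yc = trans (cong₂ (λ u v → u * M - A b c * v) (A-diff (fb≢fc ∘ sym)) (δ≢-refl (f c))) (simplify M (A b c))
        where
        simplify : ∀ m a → 1ℤ * m - a * 0ℤ ≡ m
        simplify = solve-∀

    ∑∑path-different : ∑[ a < n ] ∑[ d < n ] path a b c d ≡ A b c * G (x b) (x c)
    ∑∑path-different = begin
      ∑[ a < n ] ∑[ d < n ] path a b c d                                      ≡⟨ sum-cong-≗ ∑-path-over-d ⟩
      ∑[ a < n ] (δ≢ c a * Y a)                                               ≡⟨ ∑-except c Y ⟩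
      sum Y - Y c                                                             ≡⟨ cong₂ _-_ ∑Y Yc ⟩
      (+ n - x b) * (+ n - x c - 1ℤ) - (+ n - x b - x c) - (+ n - x c - 1ℤ)  ≡⟨ final (+ n) (x b) (x c) ⟩
      1ℤ * G (x b) (x c)                                                      ≡⟨ cong (_* G (x b) (x c)) (A-diff fb≢fc) ⟨
      A b c * G (x b) (x c)                                                   ∎
      where
      open ≡-Reasoning
      final : ∀ N u v → (N - u) * (N - v - 1ℤ) - (N - u - v) - (N - v - 1ℤ)
                          ≡ 1ℤ * ((N - 1ℤ - u) * (N - 1ℤ - v) - (N - u - v))
      final = solve-∀

  ∑∑path : ∀ b c → ∑[ a < n ] ∑[ d < n ] path a b c d ≡ A b c * G (x b) (x c)
  ∑∑path b c = by-parts (f b ≟ f c)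
    where
    by-parts : Dec (f b ≡ f c) → ∑[ a < n ] ∑[ d < n ] path a b c d ≡ A b c * G (x b) (x c)
    by-parts (yes fb≡fc) = ∑∑path-same fb≡fc
    by-parts (no fb≢fc)  = ∑∑path-different fb≢fc

  ∑-same-part : ∀ b (h : ℤ → ℤ) → ∑[ c < n ] (δ (f b) (f c) * h (x c)) ≡ x b * h (x b)
  ∑-same-part b h = begin
    ∑[ c < n ] (δ (f b) (f c) * h (x c))  ≡⟨ sum-cong-≗ (λ c → same-value c (f b ≟ f c)) ⟩
    ∑[ c < n ] (δ (f b) (f c) * h (x b))  ≡⟨ *-distribʳ-sum (h (x b)) (λ c → δ (f b) (f c)) ⟨
    x b * h (x b)                         ∎
    where
    open ≡-Reasoning
    same-value : ∀ c → Dec (f b ≡ f c) → δ (f b) (f c) * h (x c) ≡ δ (f b) (f c) * h (x b)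
    same-value c (yes fb≡fc) = cong (λ i → δ (f b) (f c) * h (s i)) (sym fb≡fc)
    same-value c (no fb≢fc)  = trans (cong (_* h (x c)) (δ-≢ fb≢fc)) (cong (_* h (x b)) (sym (δ-≢ fb≢fc)))

  ∑-over-parts : ∀ (h : ℤ → ℤ) → ∑[ b < n ] h (x b) ≡ ∑[ i < r ] (s i * h (s i))
  ∑-over-parts h = begin
    ∑[ b < n ] h (x b)                              ≡⟨ sum-cong-≗ (λ b → ∑-select (f b) (λ i → h (s i))) ⟨
    ∑[ b < n ] ∑[ i < r ] (δ (f b) i * h (s i))     ≡⟨ ∑-comm (λ b i → δ (f b) i * h (s i)) ⟩
    ∑[ i < r ] ∑[ b < n ] (δ (f b) i * h (s i))     ≡⟨ sum-cong-≗ (λ i → *-distribʳ-sum (h (s i)) (λ b → δ (f b) i)) ⟨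
    ∑[ i < r ] (∑[ b < n ] δ (f b) i * h (s i))     ≡⟨ sum-cong-≗ (λ i → cong (λ w → w * h (s i)) (sum-cong-≗ λ b → δ-sym (f b) i)) ⟩
    ∑[ i < r ] (s i * h (s i))                      ∎
    where open ≡-Reasoning

  α β : ℤ → ℤ
  α u = (+ n - 1ℤ - u) * (+ n - 1ℤ) - (+ n - u)
  β u = + n - + 2 - u

  ρ : ℤ → ℤ
  ρ u = + n * α u - β u * sum x - u * G u u

  P₂ P₃ P₄ : ℤ
  P₂ = ∑[ i < r ] (s i * s i)
  P₃ = ∑[ i < r ] (s i * s i * s i)
  P₄ = ∑[ i < r ] (s i * s i * s i * s i)

  row-sum : ∀ b → ∑[ c < n ] (A b c * G (x b) (x c)) ≡ ρ (x b)
  row-sum b = begin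
    ∑[ c < n ] (A b c * G u (x c))
      ≡⟨ sum-cong-≗ (λ c → trans (cong (_* G u (x c)) (δ≢≡1-δ (f b) (f c))) (complement (δ (f b) (f c)) (G u (x c)))) ⟩
    ∑[ c < n ] (G u (x c) - δ (f b) (f c) * G u (x c))
      ≡⟨ ∑-distrib-minus (λ c → G u (x c)) (λ c → δ (f b) (f c) * G u (x c)) ⟩
    ∑[ c < n ] G u (x c) - ∑[ c < n ] (δ (f b) (f c) * G u (x c))
      ≡⟨ cong₂ _-_ (sum-cong-≗ λ c → linear (+ n) u (x c)) (∑-same-part b (G u)) ⟩
    ∑[ c < n ] (α u - β u * x c) - u * G u u
      ≡⟨ cong (_- u * G u u) (∑-distrib-minus (λ _ → α u) (λ c → β u * x c)) ⟩
    ∑[ c < n ] α u - ∑[ c < n ] (β u * x c) - u * G u u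
      ≡⟨ cong₂ (λ v w → v - w - u * G u u) (∑-const n (α u)) (sym (*-distribˡ-sum (β u) x)) ⟩
    ρ u ∎
    where
    open ≡-Reasoning
    u = x b
    complement : ∀ e g → (1ℤ - e) * g ≡ g - e * g
    complement = solve-∀
    linear : ∀ N u v → (N - 1ℤ - u) * (N - 1ℤ - v) - (N - u - v)
                        ≡ ((N - 1ℤ - u) * (N - 1ℤ) - (N - u)) - (N - + 2 - u) * v
    linear = solve-∀

  n≡∑s : + n ≡ ∑[ i < r ] s i
  n≡∑s = begin
    + n                         ≡⟨ trans (∑-const n 1ℤ) (ℤP.*-identityʳ (+ n)) ⟨
    ∑[ b < n ] 1ℤ               ≡⟨ ∑-over-parts (λ _ → 1ℤ) ⟩
    ∑[ i < r ] (s i * 1ℤ)       ≡⟨ sum-cong-≗ (λ i → ℤP.*-identityʳ (s i)) ⟩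
    ∑[ i < r ] s i              ∎
    where open ≡-Reasoning

  twice-νP3≡∑ρ : + νP3 K + + νP3 K ≡ ∑[ b < n ] ρ (x b)
  twice-νP3≡∑ρ = begin
    + νP3 K + + νP3 K
      ≡⟨ twice-νP3≡∑⁴path ⟩
    ∑⁴ path
      ≡⟨ trans (∑-comm λ a b → ∑[ c < n ] ∑[ d < n ] path a b c d)
               (sum-cong-≗ λ b → ∑-comm λ a c → ∑[ d < n ] path a b c d) ⟩
    ∑[ b < n ] ∑[ c < n ] ∑[ a < n ] ∑[ d < n ] path a b c d
      ≡⟨ sum-cong-≗ (λ b → trans (sum-cong-≗ (∑∑path b)) (row-sum b)) ⟩
    ∑[ b < n ] ρ (x b) ∎
    where open ≡-Reasoning

  ∑ρ≡pathPoly : ∑[ b < n ] ρ (x b) ≡ pathPoly (+ n) P₂ P₃ P₄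
  ∑ρ≡pathPoly = begin
    ∑[ b < n ] ρ (x b)
      ≡⟨ ∑-over-parts ρ ⟩
    ∑[ i < r ] (s i * ρ (s i))
      ≡⟨ sum-cong-≗ (λ i → expand (+ n) (sum x) (s i)) ⟩
    ∑[ i < r ] (c₁ (sum x) * s i + c₂ (sum x) * (s i * s i) + c₃ * (s i * s i * s i) + - 1ℤ * (s i * s i * s i * s i))
      ≡⟨ ∑-linear₄ (c₁ (sum x)) (c₂ (sum x)) c₃ (- 1ℤ)
                   s (λ i → s i * s i) (λ i → s i * s i * s i) (λ i → s i * s i * s i * s i) ⟩
    c₁ (sum x) * sum s + c₂ (sum x) * P₂ + c₃ * P₃ + - 1ℤ * P₄
      ≡⟨ cong₂ (λ S N → c₁ S * N + c₂ S * P₂ + c₃ * P₃ + - 1ℤ * P₄) (∑-over-parts id) (sym n≡∑s) ⟩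
    c₁ P₂ * + n + c₂ P₂ * P₂ + c₃ * P₃ + - 1ℤ * P₄
      ≡⟨ collect (+ n) P₂ P₃ P₄ ⟩
    pathPoly (+ n) P₂ P₃ P₄ ∎
    where
    open ≡-Reasoning
    c₁ c₂ : ℤ → ℤ
    c₁ S = + n * ((+ n - 1ℤ) * (+ n - 1ℤ) - + n) - (+ n - + 2) * S
    c₂ S = S - + n * (+ n - + 2) - ((+ n - 1ℤ) * (+ n - 1ℤ) - + n)
    c₃ : ℤ
    c₃ = + 2 * (+ n - + 2)
    expand : ∀ N S u →
      u * (N * ((N - 1ℤ - u) * (N - 1ℤ) - (N - u)) - (N - + 2 - u) * S - u * ((N - 1ℤ - u) * (N - 1ℤ - u) - (N - u - u)))
        ≡ (N * ((N - 1ℤ) * (N - 1ℤ) - N) - (N - + 2) * S) * u + (S - N * (N - + 2) - ((N - 1ℤ) * (N - 1ℤ) - N)) * (u * u)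
          + + 2 * (N - + 2) * (u * u * u) + - 1ℤ * (u * u * u * u)
    expand = solve-∀
    collect : ∀ N P₂ P₃ P₄ →
      (N * ((N - 1ℤ) * (N - 1ℤ) - N) - (N - + 2) * P₂) * N + (P₂ - N * (N - + 2) - ((N - 1ℤ) * (N - 1ℤ) - N)) * P₂
        + + 2 * (N - + 2) * P₃ + - 1ℤ * P₄
        ≡ (N * N - + 3 * N + 1ℤ) * (N * N - P₂) - + 2 * N * (N - + 2) * P₂ + P₂ * P₂ + + 2 * (N - + 2) * P₃ - P₄
    collect = solve-∀

  s≡partSize : ∀ i → s i ≡ + partSize f i
  s≡partSize i = sym (+-ℕ∑ λ d → 𝟙ℕ (does (i ≟ f d)))

  partSize-total : ℕ∑.sum (partSize f) ≡ n
  partSize-total = ℤP.+-injective (sym (trans n≡∑s (trans (sum-cong-≗ s≡partSize) (sym (+-ℕ∑ (partSize f))))))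

  twice-νP3≡pathValue : + νP3 K + + νP3 K ≡ pathValue (partSize f)
  twice-νP3≡pathValue = trans twice-νP3≡∑ρ (trans ∑ρ≡pathPoly (cong₄ pathPoly (cong +_ (sym partSize-total))
    (sum-of (λ a → a ℕ.* a) (λ a → a * a) +-square)
    (sum-of (λ a → a ℕ.* a ℕ.* a) (λ a → a * a * a) +-cube)
    (sum-of (λ a → a ℕ.* a ℕ.* a ℕ.* a) (λ a → a * a * a * a) +-quartic)))
    where
    sum-of : ∀ (h : ℕ → ℕ) (h′ : ℤ → ℤ) → (∀ a → + h a ≡ h′ (+ a)) → ∑[ i < r ] h′ (s i) ≡ + ℕ∑.sum (h ∘ partSize f)
    sum-of h h′ cast = trans (sum-cong-≗ λ i → trans (cong h′ (s≡partSize i)) (sym (cast (partSize f i))))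
                               (sym (+-ℕ∑ (h ∘ partSize f)))

update₂ : ∀ {r} → Fin r → Fin r → (ℕ → ℕ) → (ℕ → ℕ) → (Fin r → ℕ) → Fin r → ℕ
update₂ i j g g′ v = updateAt (updateAt v i g) j g′

ℕ∑-updateAt : ∀ {r} (h : Fin r → ℕ → ℕ) (v : Fin r → ℕ) (i : Fin r) (g : ℕ → ℕ) →
  ℕ∑.sum (λ k → h k (updateAt v i g k)) ℕ.+ h i (v i) ≡ ℕ∑.sum (λ k → h k (v k)) ℕ.+ h i (g (v i))
ℕ∑-updateAt h v zero    g = swap (h zero (g (v zero))) (ℕ∑.sum λ k → h (suc k) (v (suc k))) (h zero (v zero))
  where
  swap : ∀ a S b → a ℕ.+ S ℕ.+ b ≡ b ℕ.+ S ℕ.+ a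
  swap = ℕSolver.solve-∀
ℕ∑-updateAt h v (suc i) g = begin
  h zero (v zero) ℕ.+ ℕ∑.sum (λ k → h (suc k) (updateAt (v ∘ suc) i g k)) ℕ.+ h (suc i) (v (suc i))
    ≡⟨ ℕP.+-assoc (h zero (v zero)) _ _ ⟩
  h zero (v zero) ℕ.+ (ℕ∑.sum (λ k → h (suc k) (updateAt (v ∘ suc) i g k)) ℕ.+ h (suc i) (v (suc i)))
    ≡⟨ cong (h zero (v zero) ℕ.+_) (ℕ∑-updateAt (h ∘ suc) (v ∘ suc) i g) ⟩
  h zero (v zero) ℕ.+ (ℕ∑.sum (λ k → h (suc k) (v (suc k))) ℕ.+ h (suc i) (g (v (suc i))))
    ≡⟨ ℕP.+-assoc (h zero (v zero)) _ _ ⟨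
  h zero (v zero) ℕ.+ ℕ∑.sum (λ k → h (suc k) (v (suc k))) ℕ.+ h (suc i) (g (v (suc i))) ∎
  where open ≡-Reasoning

ℕ∑-update₂ : ∀ {r} (h : Fin r → ℕ → ℕ) (v : Fin r → ℕ) {i j : Fin r} (g g′ : ℕ → ℕ) → ¬ i ≡ j →
  ℕ∑.sum (λ k → h k (update₂ i j g g′ v k)) ℕ.+ h i (v i) ℕ.+ h j (v j)
    ≡ ℕ∑.sum (λ k → h k (v k)) ℕ.+ h i (g (v i)) ℕ.+ h j (g′ (v j))
ℕ∑-update₂ h v {i} {j} g g′ i≢j = begin
  S₂ ℕ.+ h i (v i) ℕ.+ h j (v j)        ≡⟨ swap S₂ (h i (v i)) (h j (v j)) ⟩
  S₂ ℕ.+ h j (v j) ℕ.+ h i (v i)        ≡⟨ cong (λ y → S₂ ℕ.+ h j y ℕ.+ h i (v i)) (sym vj-kept) ⟩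
  S₂ ℕ.+ h j (u j) ℕ.+ h i (v i)        ≡⟨ cong (ℕ._+ h i (v i)) (ℕ∑-updateAt h u j g′) ⟩
  S₁ ℕ.+ h j (g′ (u j)) ℕ.+ h i (v i)   ≡⟨ cong (λ y → S₁ ℕ.+ h j (g′ y) ℕ.+ h i (v i)) vj-kept ⟩
  S₁ ℕ.+ h j (g′ (v j)) ℕ.+ h i (v i)   ≡⟨ swap S₁ (h j (g′ (v j))) (h i (v i)) ⟩
  S₁ ℕ.+ h i (v i) ℕ.+ h j (g′ (v j))   ≡⟨ cong (ℕ._+ h j (g′ (v j))) (ℕ∑-updateAt h v i g) ⟩
  ℕ∑.sum (λ k → h k (v k)) ℕ.+ h i (g (v i)) ℕ.+ h j (g′ (v j)) ∎
  where
  open ≡-Reasoning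
  u = updateAt v i g
  S₁ = ℕ∑.sum λ k → h k (u k)
  S₂ = ℕ∑.sum λ k → h k (update₂ i j g g′ v k)
  vj-kept : u j ≡ v j
  vj-kept = updateAt-minimal j i v (i≢j ∘ sym)
  swap : ∀ a b c → a ℕ.+ b ℕ.+ c ≡ a ℕ.+ c ℕ.+ b
  swap = ℕSolver.solve-∀

transfer : ∀ {r} → Fin r → Fin r → (Fin r → ℕ) → Fin r → ℕ
transfer i j = update₂ i j ℕ.pred ℕ.suc

ℕ∑-square-≤ : ∀ {r} (z : Fin r → ℕ) → p₂ z ≤ ℕ∑.sum z ℕ.* ℕ∑.sum z
ℕ∑-square-≤ {ℕ.zero}  z = ℕ.z≤n
ℕ∑-square-≤ {ℕ.suc r} z = begin
  a ℕ.* a ℕ.+ p₂ (z ∘ suc)            ≤⟨ ℕP.+-monoʳ-≤ (a ℕ.* a) (ℕ∑-square-≤ (z ∘ suc)) ⟩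
  a ℕ.* a ℕ.+ S ℕ.* S                 ≤⟨ ℕP.m≤m+n _ (2 ℕ.* (a ℕ.* S)) ⟩
  a ℕ.* a ℕ.+ S ℕ.* S ℕ.+ 2 ℕ.* (a ℕ.* S) ≡⟨ square-of-sum a S ⟩
  (a ℕ.+ S) ℕ.* (a ℕ.+ S)             ∎
  where
  open ℕP.≤-Reasoning
  a = z zero
  S = ℕ∑.sum (z ∘ suc)
  square-of-sum : ∀ a S → a ℕ.* a ℕ.+ S ℕ.* S ℕ.+ 2 ℕ.* (a ℕ.* S) ≡ (a ℕ.+ S) ℕ.* (a ℕ.+ S)
  square-of-sum = ℕSolver.solve-∀

splitPathPoly : ℤ → ℤ → ℤ → ℤ → ℤ → ℤ → ℤ
splitPathPoly R U₂ U₃ U₄ a b =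
  pathPoly (R + a + b) (U₂ + a * a + b * b) (U₃ + a * a * a + b * b * b) (U₄ + a * a * a * a + b * b * b * b)

pathValue-decompose : ∀ {r} (u z : Fin r → ℕ) (a b : ℕ) →
  (∀ (h : ℕ → ℕ) → h 0 ≡ 0 → ℕ∑.sum (h ∘ u) ≡ ℕ∑.sum (h ∘ z) ℕ.+ h a ℕ.+ h b) →
  pathValue u ≡ splitPathPoly (+ ℕ∑.sum z) (+ p₂ z) (+ p₃ z) (+ p₄ z) (+ a) (+ b)
pathValue-decompose u z a b split = cong₄ pathPoly
  (cong +_ (split id refl))
  (trans (cong +_ (split (λ x → x ℕ.* x) refl))
         (cong₂ (λ x y → + p₂ z + x + y) (+-square a) (+-square b)))
  (trans (cong +_ (split (λ x → x ℕ.* x ℕ.* x) refl))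
         (cong₂ (λ x y → + p₃ z + x + y) (+-cube a) (+-cube b)))
  (trans (cong +_ (split (λ x → x ℕ.* x ℕ.* x ℕ.* x) refl))
         (cong₂ (λ x y → + p₄ z + x + y) (+-quartic a) (+-quartic b)))

0≤+ : ∀ k → 0ℤ ℤ.≤ + k
0≤+ k = ℤ.+≤+ ℕ.z≤n

0≤-+ : ∀ {a b} → 0ℤ ℤ.≤ a → 0ℤ ℤ.≤ b → 0ℤ ℤ.≤ a + b
0≤-+ = ℤP.+-mono-≤

0≤-* : ∀ {a b} → 0ℤ ℤ.≤ a → 0ℤ ℤ.≤ b → 0ℤ ℤ.≤ a * b
0≤-* (ℤ.+≤+ {n = k} _) (ℤ.+≤+ {n = l} _) = subst (0ℤ ℤ.≤_) (ℤP.pos-* k l) (0≤+ (k ℕ.* l))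

transferGain : ℤ → ℤ → ℤ → ℤ → ℤ
transferGain Q D R U₂ = + 4 * D * ((m - + 2) * R - U₂) + + 2 * D * (R * (m - + 3) + + 2 * Q * (Q + D))
  where m = R + (1ℤ + (Q + D)) + Q

splitPathPoly-transfer : ∀ Q D R U₂ U₃ U₄ →
  splitPathPoly R U₂ U₃ U₄ (Q + D) (1ℤ + Q) ≡ splitPathPoly R U₂ U₃ U₄ (1ℤ + (Q + D)) Q + transferGain Q D R U₂
splitPathPoly-transfer = expanded
  where
  expanded : ∀ Q D R U₂ U₃ U₄ →
    let a = 1ℤ + (Q + D) ; b = Q ; a′ = Q + D ; b′ = 1ℤ + Q
        m  = R + a + b
        m′ = R + a′ + b′
        P₂ = U₂ + a * a + b * b
        P₃ = U₃ + a * a * a + b * b * b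
        P₄ = U₄ + a * a * a * a + b * b * b * b
        P₂′ = U₂ + a′ * a′ + b′ * b′
        P₃′ = U₃ + a′ * a′ * a′ + b′ * b′ * b′
        P₄′ = U₄ + a′ * a′ * a′ * a′ + b′ * b′ * b′ * b′
    in (m′ * m′ - + 3 * m′ + 1ℤ) * (m′ * m′ - P₂′) - + 2 * m′ * (m′ - + 2) * P₂′ + P₂′ * P₂′ + + 2 * (m′ - + 2) * P₃′ - P₄′
       ≡ (m * m - + 3 * m + 1ℤ) * (m * m - P₂) - + 2 * m * (m - + 2) * P₂ + P₂ * P₂ + + 2 * (m - + 2) * P₃ - P₄
         + (+ 4 * D * ((m - + 2) * R - U₂) + + 2 * D * (R * (m - + 3) + + 2 * Q * (Q + D)))
  expanded = solve-∀

transferGain-nonneg : ∀ q d R {U₂} → U₂ ℤ.≤ + R * + R → 0ℤ ℤ.≤ transferGain (+ q) (+ d) (+ R) U₂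
transferGain-nonneg q ℕ.zero    R _ = 0≤+ 0
transferGain-nonneg q (ℕ.suc e) R {U₂} U₂≤R² =
  0≤-+ (0≤-* (0≤-* (0≤+ 4) (0≤+ (ℕ.suc e))) first) (0≤-* (0≤-* (0≤+ 2) (0≤+ (ℕ.suc e))) (0≤-+ (second R) third))
  where
  Q = + q
  E = + e
  first : 0ℤ ℤ.≤ (+ R + (1ℤ + (Q + (1ℤ + E))) + Q - + 2) * + R - U₂
  first = subst (0ℤ ℤ.≤_) (sym (rearrange Q E (+ R) U₂))
            (0≤-+ (0≤-* (0≤-+ (0≤-* (0≤+ 2) (0≤+ q)) (0≤+ e)) (0≤+ R)) (ℤP.i≤j⇒0≤j-i U₂≤R²))
    where
    rearrange : ∀ Q E R U → (R + (1ℤ + (Q + (1ℤ + E))) + Q - + 2) * R - U ≡ (+ 2 * Q + E) * R + (R * R - U)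
    rearrange = solve-∀
  second : ∀ R → 0ℤ ℤ.≤ + R * (+ R + (1ℤ + (Q + (1ℤ + E))) + Q - + 3)
  second ℕ.zero     = 0≤+ 0
  second (ℕ.suc R′) = subst (0ℤ ℤ.≤_) (sym (rearrange Q E (+ R′)))
                        (0≤-* (0≤+ (ℕ.suc R′)) (0≤-+ (0≤-+ (0≤-* (0≤+ 2) (0≤+ q)) (0≤+ e)) (0≤+ R′)))
    where
    rearrange : ∀ Q E R′ → (1ℤ + R′) * (1ℤ + R′ + (1ℤ + (Q + (1ℤ + E))) + Q - + 3) ≡ (1ℤ + R′) * (+ 2 * Q + E + R′)
    rearrange = solve-∀
  third : 0ℤ ℤ.≤ + 2 * Q * (Q + (1ℤ + E))
  third = 0≤-* (0≤-* (0≤+ 2) (0≤+ q)) (0≤+ (q ℕ.+ ℕ.suc e))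

splitPathPoly-transfer-≤ : ∀ q d R {U₂} U₃ U₄ → U₂ ℤ.≤ + R * + R →
  splitPathPoly (+ R) U₂ U₃ U₄ (+ ℕ.suc (q ℕ.+ d)) (+ q) ℤ.≤ splitPathPoly (+ R) U₂ U₃ U₄ (+ (q ℕ.+ d)) (+ ℕ.suc q)
splitPathPoly-transfer-≤ q d R {U₂} U₃ U₄ U₂≤R² =
  subst (before ℤ.≤_) (sym (splitPathPoly-transfer (+ q) (+ d) (+ R) U₂ U₃ U₄))
    (ℤP.i≤i+j before (transferGain (+ q) (+ d) (+ R) U₂) ⦃ ℤ.nonNegative (transferGain-nonneg q d R U₂≤R²) ⦄)
  where before = splitPathPoly (+ R) U₂ U₃ U₄ (+ ℕ.suc (q ℕ.+ d)) (+ q)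

others : ∀ {r} → Fin r → Fin r → (Fin r → ℕ) → Fin r → ℕ
others i j = update₂ i j (λ _ → 0) (λ _ → 0)

ℕ∑-others : ∀ {r} (v : Fin r → ℕ) {i j : Fin r} → ¬ i ≡ j → ∀ (h : ℕ → ℕ) → h 0 ≡ 0 →
  ℕ∑.sum (h ∘ v) ≡ ℕ∑.sum (h ∘ others i j v) ℕ.+ h (v i) ℕ.+ h (v j)
ℕ∑-others v i≢j h h0≡0 = sym (trans (ℕ∑-update₂ (λ _ → h) v (λ _ → 0) (λ _ → 0) i≢j)
  (trans (cong (λ y → ℕ∑.sum (h ∘ v) ℕ.+ y ℕ.+ y) h0≡0) (trans (ℕP.+-identityʳ _) (ℕP.+-identityʳ _))))

ℕ∑-transfer : ∀ {r} (v : Fin r → ℕ) {i j : Fin r} → ¬ i ≡ j → ∀ (h : ℕ → ℕ) → h 0 ≡ 0 →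
  ℕ∑.sum (h ∘ transfer i j v) ≡ ℕ∑.sum (h ∘ others i j v) ℕ.+ h (ℕ.pred (v i)) ℕ.+ h (ℕ.suc (v j))
ℕ∑-transfer v {i} {j} i≢j h h0≡0 = ℕP.+-cancelʳ-≡ (h (v i) ℕ.+ h (v j)) _ _ (begin
  W ℕ.+ (h (v i) ℕ.+ h (v j))                                ≡⟨ ℕP.+-assoc W _ _ ⟨
  W ℕ.+ h (v i) ℕ.+ h (v j)                                  ≡⟨ ℕ∑-update₂ (λ _ → h) v ℕ.pred ℕ.suc i≢j ⟩
  ℕ∑.sum (h ∘ v) ℕ.+ h (ℕ.pred (v i)) ℕ.+ h (ℕ.suc (v j))    ≡⟨ cong (λ S → S ℕ.+ _ ℕ.+ _) (ℕ∑-others v i≢j h h0≡0) ⟩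
  Z ℕ.+ h (v i) ℕ.+ h (v j) ℕ.+ h (ℕ.pred (v i)) ℕ.+ h (ℕ.suc (v j))
    ≡⟨ regroup Z (h (v i)) (h (v j)) (h (ℕ.pred (v i))) (h (ℕ.suc (v j))) ⟩
  Z ℕ.+ h (ℕ.pred (v i)) ℕ.+ h (ℕ.suc (v j)) ℕ.+ (h (v i) ℕ.+ h (v j)) ∎)
  where
  open ≡-Reasoning
  W = ℕ∑.sum (h ∘ transfer i j v)
  Z = ℕ∑.sum (h ∘ others i j v)
  regroup : ∀ Z a b c e → Z ℕ.+ a ℕ.+ b ℕ.+ c ℕ.+ e ≡ Z ℕ.+ c ℕ.+ e ℕ.+ (a ℕ.+ b)
  regroup = ℕSolver.solve-∀

transfer-preserves-sum : ∀ {r} (v : Fin r → ℕ) {i j : Fin r} → ¬ i ≡ j → 0 < v i →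
  ℕ∑.sum (transfer i j v) ≡ ℕ∑.sum v
transfer-preserves-sum v {i} {j} i≢j 0<vi = begin
  ℕ∑.sum (transfer i j v)                           ≡⟨ ℕ∑-transfer v i≢j id refl ⟩
  Z ℕ.+ ℕ.pred (v i) ℕ.+ ℕ.suc (v j)                ≡⟨ shift 0<vi ⟩
  Z ℕ.+ v i ℕ.+ v j                                 ≡⟨ ℕ∑-others v i≢j id refl ⟨
  ℕ∑.sum v                                          ∎
  where
  open ≡-Reasoning
  Z = ℕ∑.sum (others i j v)
  shift : ∀ {a b} → 0 < a → Z ℕ.+ ℕ.pred a ℕ.+ ℕ.suc b ≡ Z ℕ.+ a ℕ.+ b
  shift {ℕ.suc a} {b} _ = trans (ℕP.+-suc (Z ℕ.+ a) b) (cong (ℕ._+ b) (sym (ℕP.+-suc Z a)))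

pathValue-transfer : ∀ {r} (v : Fin r → ℕ) {i j : Fin r} → v j < v i → pathValue v ℤ.≤ pathValue (transfer i j v)
pathValue-transfer v {i} {j} vj<vi = begin
  pathValue v                            ≡⟨ pathValue-decompose v z (ℕ.suc (q ℕ.+ d)) q split-v ⟩
  splitPathPoly R U₂ U₃ U₄ (+ ℕ.suc (q ℕ.+ d)) (+ q)
    ≤⟨ splitPathPoly-transfer-≤ q d (ℕ∑.sum z) U₃ U₄ U₂≤R² ⟩
  splitPathPoly R U₂ U₃ U₄ (+ (q ℕ.+ d)) (+ ℕ.suc q)
    ≡⟨ pathValue-decompose (transfer i j v) z (q ℕ.+ d) (ℕ.suc q) split-w ⟨
  pathValue (transfer i j v)             ∎
  where
  open ℤP.≤-Reasoning
  i≢j : ¬ i ≡ j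
  i≢j refl = ℕP.<-irrefl refl vj<vi
  q = v j
  d = v i ℕ.∸ ℕ.suc q
  vi≡ : v i ≡ ℕ.suc (q ℕ.+ d)
  vi≡ = sym (ℕP.m+[n∸m]≡n vj<vi)
  z = others i j v
  R = + ℕ∑.sum z
  U₂ = + p₂ z
  U₃ = + p₃ z
  U₄ = + p₄ z
  U₂≤R² : U₂ ℤ.≤ R * R
  U₂≤R² = subst (U₂ ℤ.≤_) (ℤP.pos-* (ℕ∑.sum z) (ℕ∑.sum z)) (ℤ.+≤+ (ℕ∑-square-≤ z))
  split-v : ∀ h → h 0 ≡ 0 → ℕ∑.sum (h ∘ v) ≡ ℕ∑.sum (h ∘ z) ℕ.+ h (ℕ.suc (q ℕ.+ d)) ℕ.+ h q
  split-v h h0≡0 = trans (ℕ∑-others v i≢j h h0≡0) (cong (λ y → ℕ∑.sum (h ∘ z) ℕ.+ h y ℕ.+ h q) vi≡)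
  split-w : ∀ h → h 0 ≡ 0 → ℕ∑.sum (h ∘ transfer i j v) ≡ ℕ∑.sum (h ∘ z) ℕ.+ h (q ℕ.+ d) ℕ.+ h (ℕ.suc q)
  split-w h h0≡0 =
    trans (ℕ∑-transfer v i≢j h h0≡0) (cong (λ y → ℕ∑.sum (h ∘ z) ℕ.+ h (ℕ.pred y) ℕ.+ h (ℕ.suc q)) vi≡)

dist : ∀ {r} → (Fin r → ℕ) → (Fin r → ℕ) → ℕ
dist v t = ℕ∑.sum λ k → ℕ.∣ v k - t k ∣

∣-∣-pred : ∀ {a t} → t < a → ℕ.∣ a - t ∣ ≡ ℕ.suc ℕ.∣ ℕ.pred a - t ∣
∣-∣-pred {ℕ.suc a} {t} (ℕ.s≤s t≤a) =
  trans (ℕP.m≤n⇒∣n-m∣≡n∸m (ℕP.m≤n⇒m≤1+n t≤a))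
        (trans (ℕP.+-∸-assoc 1 t≤a) (cong ℕ.suc (sym (ℕP.m≤n⇒∣n-m∣≡n∸m t≤a))))

∣-∣-suc : ∀ {a t} → a < t → ℕ.∣ a - t ∣ ≡ ℕ.suc ℕ.∣ ℕ.suc a - t ∣
∣-∣-suc {a} {ℕ.suc t} a<t =
  trans (ℕP.∣-∣-comm a (ℕ.suc t)) (trans (∣-∣-pred a<t) (cong ℕ.suc (ℕP.∣-∣-comm t a)))

dist-transfer : ∀ {r} (v t : Fin r → ℕ) {i j} → ¬ i ≡ j → t i < v i → v j < t j →
  ℕ.suc (ℕ.suc (dist (transfer i j v) t)) ≡ dist v t
dist-transfer v t {i} {j} i≢j ti<vi vj<tj = ℕP.+-cancelʳ-≡ (A ℕ.+ B) _ _ (begin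
  ℕ.suc (ℕ.suc (dist w t)) ℕ.+ (A ℕ.+ B)   ≡⟨ regroup (dist w t) A B ⟩
  dist w t ℕ.+ ℕ.suc A ℕ.+ ℕ.suc B         ≡⟨ cong₂ (λ x y → dist w t ℕ.+ x ℕ.+ y) (∣-∣-pred ti<vi) (∣-∣-suc vj<tj) ⟨
  dist w t ℕ.+ ℕ.∣ v i - t i ∣ ℕ.+ ℕ.∣ v j - t j ∣ ≡⟨ ℕ∑-update₂ (λ k x → ℕ.∣ x - t k ∣) v ℕ.pred ℕ.suc i≢j ⟩
  dist v t ℕ.+ A ℕ.+ B                     ≡⟨ ℕP.+-assoc (dist v t) A B ⟩
  dist v t ℕ.+ (A ℕ.+ B)                   ∎)
  where
  open ≡-Reasoning
  w = transfer i j v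
  A = ℕ.∣ ℕ.pred (v i) - t i ∣
  B = ℕ.∣ ℕ.suc (v j) - t j ∣
  regroup : ∀ D A B → ℕ.suc (ℕ.suc D) ℕ.+ (A ℕ.+ B) ≡ D ℕ.+ ℕ.suc A ℕ.+ ℕ.suc B
  regroup = ℕSolver.solve-∀

ℕ∑-mono-≤ : ∀ {r} {v t : Fin r → ℕ} → (∀ i → v i ≤ t i) → ℕ∑.sum v ≤ ℕ∑.sum t
ℕ∑-mono-≤ {ℕ.zero}  v≤t = ℕ.z≤n
ℕ∑-mono-≤ {ℕ.suc r} v≤t = ℕP.+-mono-≤ (v≤t zero) (ℕ∑-mono-≤ (v≤t ∘ suc))

≤-pointwise-∧-sums⇒≗ : ∀ {r} {v t : Fin r → ℕ} → (∀ i → v i ≤ t i) → ℕ∑.sum v ≡ ℕ∑.sum t →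
  ∀ i → v i ≡ t i
≤-pointwise-∧-sums⇒≗ {ℕ.suc r} {v} {t} v≤t sums≡ = pointwise
  where
  tails≤ : ℕ∑.sum (v ∘ suc) ≤ ℕ∑.sum (t ∘ suc)
  tails≤ = ℕ∑-mono-≤ (v≤t ∘ suc)
  heads≡ : v zero ≡ t zero
  heads≡ = ℕP.≤-antisym (v≤t zero)
    (ℕP.+-cancelʳ-≤ (ℕ∑.sum (t ∘ suc)) (t zero) (v zero)
      (ℕP.≤-trans (ℕP.≤-reflexive (sym sums≡)) (ℕP.+-monoʳ-≤ (v zero) tails≤)))
  pointwise : ∀ i → v i ≡ t i
  pointwise zero    = heads≡
  pointwise (suc i) = ≤-pointwise-∧-sums⇒≗ (v≤t ∘ suc)
    (ℕP.+-cancelˡ-≡ (v zero) _ _ (trans sums≡ (cong (ℕ._+ ℕ∑.sum (t ∘ suc)) (sym heads≡)))) i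

Balanced : ∀ {r} → (Fin r → ℕ) → Set
Balanced t = ∀ i j → t i ≤ ℕ.suc (t j)

module _ {r} (Φ : (Fin r → ℕ) → ℤ)
         (Φ-cong : ∀ {v w} → (∀ i → v i ≡ w i) → Φ v ≡ Φ w)
         (Φ-transfer : ∀ v {i j} → v j < v i → Φ v ℤ.≤ Φ (transfer i j v))
         {t : Fin r → ℕ} (balanced : Balanced t) where

  balanced-maximises : ∀ v → ℕ∑.sum v ≡ ℕ∑.sum t → Φ v ℤ.≤ Φ t
  balanced-maximises v = smooth (dist v t) v ℕP.≤-refl
    where
    smooth : ∀ D v → dist v t ≤ D → ℕ∑.sum v ≡ ℕ∑.sum t → Φ v ℤ.≤ Φ t
    smooth D v dist≤D sums≡ with FinP.any? (λ i → t i ℕ.<? v i)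
    ... | no ∄excess =
      ℤP.≤-reflexive (Φ-cong (≤-pointwise-∧-sums⇒≗ (λ i → ℕP.≮⇒≥ (∄excess ∘ (i ,_))) sums≡))
    ... | yes (i , ti<vi) with FinP.any? (λ j → v j ℕ.<? t j)
    ...   | no ∄deficit = ⊥-elim (ℕP.<-irrefl
            (≤-pointwise-∧-sums⇒≗ (λ j → ℕP.≮⇒≥ (∄deficit ∘ (j ,_))) (sym sums≡) i) ti<vi)
    ...   | yes (j , vj<tj) = step D dist≤D
      where
      vj<vi : v j < v i
      vj<vi = ℕP.<-≤-trans vj<tj (ℕP.≤-trans (balanced j i) ti<vi)
      i≢j : ¬ i ≡ j
      i≢j refl = ℕP.<-irrefl refl vj<vi
      step : ∀ D → dist v t ≤ D → Φ v ℤ.≤ Φ t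
      step D dist≤D with ℕP.≤-trans (ℕP.≤-reflexive (dist-transfer v t i≢j ti<vi vj<tj)) dist≤D
      step (ℕ.suc (ℕ.suc D)) _ | ℕ.s≤s (ℕ.s≤s dist′≤D) =
        ℤP.≤-trans (Φ-transfer v vj<vi) (smooth D (transfer i j v) dist′≤D
          (trans (transfer-preserves-sum v i≢j (ℕP.<-≤-trans (ℕ.s≤s ℕ.z≤n) ti<vi)) sums≡))

module ResidueClasses (k : ℕ) where

  count : ℕ → ℕ → ℕ
  count c m = ℕ∑.sum {m} λ x → 𝟙ℕ (c ℕ.≡ᵇ toℕ x ℕ.% ℕ.suc k)

  count-suc : ∀ c m → count c (ℕ.suc m) ≡ count c m ℕ.+ 𝟙ℕ (c ℕ.≡ᵇ m ℕ.% ℕ.suc k)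
  count-suc c m = trans (ℕ∑.sum-init-last {m} (λ x → 𝟙ℕ (c ℕ.≡ᵇ toℕ x ℕ.% ℕ.suc k)))
    (cong₂ ℕ._+_ (ℕ∑.sum-cong-≗ {m} λ x → cong (λ y → 𝟙ℕ (c ℕ.≡ᵇ y ℕ.% ℕ.suc k)) (FinP.toℕ-inject₁ x))
                 (cong (λ y → 𝟙ℕ (c ℕ.≡ᵇ y ℕ.% ℕ.suc k)) (FinP.toℕ-fromℕ m)))

  suc-% : ∀ m → ℕ.suc m ℕ.% ℕ.suc k ≡ ℕ.suc (m ℕ.% ℕ.suc k) ℕ.% ℕ.suc k
  suc-% m = trans (cong (λ y → ℕ.suc y ℕ.% ℕ.suc k) (DivMod.m≡m%n+[m/n]*n m (ℕ.suc k)))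
                  (DivMod.[m+kn]%n≡m%n (ℕ.suc (m ℕ.% ℕ.suc k)) (m ℕ./ ℕ.suc k) (ℕ.suc k))

  count-step : ∀ m {Q} → (∀ c → c < ℕ.suc k → count c m ≡ Q ℕ.+ 𝟙ℕ (c <ᵇ m ℕ.% ℕ.suc k)) →
    ∀ c → c < ℕ.suc k → count c (ℕ.suc m) ≡ Q ℕ.+ 𝟙ℕ (c <ᵇ ℕ.suc (m ℕ.% ℕ.suc k))
  count-step m {Q} formula c c<r =
    trans (count-suc c m) (trans (cong (ℕ._+ 𝟙ℕ (c ℕ.≡ᵇ a)) (formula c c<r))
      (trans (ℕP.+-assoc Q _ _) (cong (Q ℕ.+_) (𝟙ℕ-<ᵇ-suc c a))))
    where a = m ℕ.% ℕ.suc k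

  count-formula : ∀ m → ∃ λ Q → ∀ c → c < ℕ.suc k → count c m ≡ Q ℕ.+ 𝟙ℕ (c <ᵇ m ℕ.% ℕ.suc k)
  count-formula ℕ.zero = 0 , λ _ _ → refl
  count-formula (ℕ.suc m) with count-formula m | ℕ.suc (m ℕ.% ℕ.suc k) ℕP.<? ℕ.suc k
  ... | Q , formula | yes 1+a<r = Q , λ c c<r → begin
    count c (ℕ.suc m)                               ≡⟨ count-step m formula c c<r ⟩
    Q ℕ.+ 𝟙ℕ (c <ᵇ ℕ.suc a)                         ≡⟨ cong (λ y → Q ℕ.+ 𝟙ℕ (c <ᵇ y)) (DivMod.m<n⇒m%n≡m 1+a<r) ⟨
    Q ℕ.+ 𝟙ℕ (c <ᵇ ℕ.suc a ℕ.% ℕ.suc k)             ≡⟨ cong (λ y → Q ℕ.+ 𝟙ℕ (c <ᵇ y)) (suc-% m) ⟨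
    Q ℕ.+ 𝟙ℕ (c <ᵇ ℕ.suc m ℕ.% ℕ.suc k)             ∎
    where
    open ≡-Reasoning
    a = m ℕ.% ℕ.suc k
  ... | Q , formula | no 1+a≮r  = ℕ.suc Q , λ c c<r → begin
    count c (ℕ.suc m)                               ≡⟨ count-step m formula c c<r ⟩
    Q ℕ.+ 𝟙ℕ (c <ᵇ ℕ.suc a)                         ≡⟨ cong (Q ℕ.+_) (𝟙ℕ-<ᵇ (subst (c <_) (sym 1+a≡r) c<r)) ⟩
    Q ℕ.+ 1                                         ≡⟨ trans (ℕP.+-comm Q 1) (sym (ℕP.+-identityʳ (ℕ.suc Q))) ⟩
    ℕ.suc Q ℕ.+ 𝟙ℕ (c <ᵇ 0)                         ≡⟨ cong (λ y → ℕ.suc Q ℕ.+ 𝟙ℕ (c <ᵇ y)) (DivMod.n%n≡0 (ℕ.suc k)) ⟨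
    ℕ.suc Q ℕ.+ 𝟙ℕ (c <ᵇ ℕ.suc k ℕ.% ℕ.suc k)       ≡⟨ cong (λ y → ℕ.suc Q ℕ.+ 𝟙ℕ (c <ᵇ y ℕ.% ℕ.suc k)) 1+a≡r ⟨
    ℕ.suc Q ℕ.+ 𝟙ℕ (c <ᵇ ℕ.suc a ℕ.% ℕ.suc k)       ≡⟨ cong (λ y → ℕ.suc Q ℕ.+ 𝟙ℕ (c <ᵇ y)) (suc-% m) ⟨
    ℕ.suc Q ℕ.+ 𝟙ℕ (c <ᵇ ℕ.suc m ℕ.% ℕ.suc k)       ∎
    where
    open ≡-Reasoning
    a = m ℕ.% ℕ.suc k
    1+a≡r : ℕ.suc a ≡ ℕ.suc k
    1+a≡r = ℕP.≤-antisym (DivMod.m%n<n m (ℕ.suc k)) (ℕP.≮⇒≥ 1+a≮r)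

  residue : ∀ {n} → Fin n → Fin (ℕ.suc k)
  residue v = toℕ v DivMod.mod ℕ.suc k

  turán-balanced : ∀ n → Balanced (partSize {n} residue)
  turán-balanced n i j with count-formula n
  ... | Q , formula = begin
    partSize {n} residue i                ≡⟨ size i ⟩
    Q ℕ.+ 𝟙ℕ (toℕ i <ᵇ n ℕ.% ℕ.suc k)     ≤⟨ ℕP.+-monoʳ-≤ Q (𝟙ℕ≤1 _) ⟩
    Q ℕ.+ 1                               ≡⟨ ℕP.+-comm Q 1 ⟩
    ℕ.suc Q                               ≤⟨ ℕ.s≤s (ℕP.m≤m+n Q _) ⟩
    ℕ.suc (Q ℕ.+ 𝟙ℕ (toℕ j <ᵇ n ℕ.% ℕ.suc k)) ≡⟨ cong ℕ.suc (size j) ⟨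
    ℕ.suc (partSize {n} residue j)        ∎
    where
    open ℕP.≤-Reasoning
    𝟙ℕ≤1 : ∀ b → 𝟙ℕ b ≤ 1
    𝟙ℕ≤1 true  = ℕP.≤-refl
    𝟙ℕ≤1 false = ℕ.z≤n
    size : ∀ i → partSize {n} residue i ≡ Q ℕ.+ 𝟙ℕ (toℕ i <ᵇ n ℕ.% ℕ.suc k)
    size i = trans (ℕ∑.sum-cong-≗ {n} λ d → cong 𝟙ℕ (trans (does-≟ i _) (cong (toℕ i ℕ.≡ᵇ_)
                     (FinP.toℕ-fromℕ< (DivMod.m%n<n (toℕ d) (ℕ.suc k))))))
                   (formula (toℕ i) (FinP.toℕ<n i))

νP3-turán-maximal : ∀ {n k} (f : Fin n → Fin (ℕ.suc k)) →
  νP3 (completeMultipartite f) ≤ νP3 (turán n (ℕ.suc k))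
νP3-turán-maximal {n} {k} f = +-self-cancel-≤ (ℤ.drop‿+≤+ (begin
  + νP3 (completeMultipartite f) + + νP3 (completeMultipartite f)
    ≡⟨ twice-νP3≡pathValue f ⟩
  pathValue (partSize f)
    ≤⟨ balanced-maximises pathValue pathValue-cong pathValue-transfer (turán-balanced n) (partSize f) sizes≡ ⟩
  pathValue (partSize {n} residue)
    ≡⟨ twice-νP3≡pathValue (residue {n}) ⟨
  + νP3 (turán n (ℕ.suc k)) + + νP3 (turán n (ℕ.suc k)) ∎))
  where
  open ResidueClasses k
  open CompleteMultipartite using (twice-νP3≡pathValue; partSize-total)
  open ℤP.≤-Reasoning
  sizes≡ : ℕ∑.sum (partSize f) ≡ ℕ∑.sum (partSize {n} residue)
  sizes≡ = trans (partSize-total f) (sym (partSize-total (residue {n})))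
  +-self-cancel-≤ : ∀ {a b} → a ℕ.+ a ≤ b ℕ.+ b → a ≤ b
  +-self-cancel-≤ a+a≤b+b = ℕP.≮⇒≥ λ b<a → ℕP.<⇒≱ (ℕP.+-mono-< b<a b<a) a+a≤b+b

lemma3p5 : (n r : ℕ) → 4 ≤ n → 4 ≤ r → (G : Graph n) →
    IsCompleteMultipartite r G → νP3 G ≤ νP3 (turán n r)
lemma3p5 n (ℕ.suc k) _ _ G (f , _ , adj≡) =
  ℕP.≤-trans (ℕP.≤-reflexive (νP3-cong G (completeMultipartite f) adj≡)) (νP3-turán-maximal f)
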